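{- Let $(X,\le)$ be a poset, $E$ an equivalence relation on $X$ with ${\le}\subseteq E$, $\alpha$ an order automorphism and $\beta$ a self-inverse dual order automorphism of $(X,\le)$ with $\alpha,\beta\subseteq E$ and $\beta=\alpha\circ\beta\circ\alpha$, and let $\mathbf A=\mathbf{Dq}(\mathbf E)=\langle\mathsf{Up}(\mathbf E),\cap,\cup,\circ,1,0,{\sim},{ - },'\rangle$. Then for each $n\in\omega$ there are self-inverse dual order automorphisms $\beta_{\triangledown n}$ and $\beta_{\vartriangle n}$ of $(X,\le)$ such that (i) $\beta_{\triangledown n},\beta_{\vartriangle n}\subseteq E$; (ii) $\beta_{\triangledown n}=\alpha\circ\beta_{\triangledown n}\circ\alpha$ and $\alpha\circ\beta_{\vartriangle n}\circ\alpha=\beta_{\vartriangle n}$; (iii) $R^{\triangledown n}=\alpha\circ\beta_{\triangledown n}\circ R^{c}\circ\beta_{\triangledown n}$ and $R^{\vartriangle n}=\alpha\circ\beta_{\vartriangle n}\circ R^{c}\circ\beta_{\vartriangle n}$ for all $R\in\mathsf{Up}(\mathbf E)$.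
   Context: Relations: $R\circ S=\{(x,y)\mid\exists z\,((x,z)\in R,(z,y)\in S)\}$, $R^{\smile}$ the converse; functions are identified with their graphs. Order automorphism: bijection with $x\le y\iff\alpha(x)\le\alpha(y)$; dual order automorphism: bijection with $x\le y\iff\beta(y)\le\beta(x)$; self-inverse: $\beta\circ\beta=\mathrm{id}_X$. $E$ is ordered by $(u,v)\preceq(x,y)$ iff $x\le u$ and $v\le y$; $\mathsf{Up}(\mathbf E)$ is the set of up-sets of $\mathbf E=(E,\preceq)$; $R^{c}=E\setminus R$. In $\mathbf{Dq}(\mathbf E)$: $1={\le}$, $0=\alpha\circ(\le^{c})^{\smile}$, ${\sim}R=(R^{\smile}\circ0^{c})^{c}$, ${ - }R=(0^{c}\circ R^{\smile})^{c}$, $R'=\alpha\circ\beta\circ R^{c}\circ\beta$. For $n\in\omega$: $R^{\triangledown n}={\sim}^{2n}(R')$ and $R^{\vartriangle n}={ - }^{2n}(R')$, where ${\sim}^k,{ - }^k$ denote $k$-fold applications. -}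

module Defs where

open import Level using (0ℓ)
open import Data.Nat using (ℕ; zero; suc; _*_)
open import Data.Product using (Σ; ∃; _×_; _,_)
open import Relation.Nullary using (¬_)
open import Relation.Binary.Core using (Rel; _⇔_)
open import Relation.Binary.Structures using (IsPartialOrder; IsEquivalence)
open import Relation.Binary.PropositionalEquality using (_≡_)
open import Function.Definitions using (Bijective)

_⨾_ : {X : Set} → Rel X 0ℓ → Rel X 0ℓ → Rel X 0ℓ
(R ⨾ S) x y = ∃ λ z → R x z × S z y
infixr 9 _⨾_

_⌣ : {X : Set} → Rel X 0ℓ → Rel X 0ℓ
(R ⌣) x y = R y x

graph : {X : Set} → (X → X) → Rel X 0ℓ
graph f x y = f x ≡ y

_⊆ᵣ_ : {X : Set} → Rel X 0ℓ → Rel X 0ℓ → Set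
R ⊆ᵣ S = ∀ x y → R x y → S x y

IsOrderAut : {X : Set} → Rel X 0ℓ → (X → X) → Set
IsOrderAut _≤_ α = Bijective _≡_ _≡_ α × (∀ x y → (x ≤ y → α x ≤ α y) × (α x ≤ α y → x ≤ y))

IsDualOrderAut : {X : Set} → Rel X 0ℓ → (X → X) → Set
IsDualOrderAut _≤_ β = Bijective _≡_ _≡_ β × (∀ x y → (x ≤ y → β y ≤ β x) × (β y ≤ β x → x ≤ y))

SelfInverse : {X : Set} → (X → X) → Set
SelfInverse β = ∀ x → β (β x) ≡ x

iter : {X : Set} → ℕ → (Rel X 0ℓ → Rel X 0ℓ) → Rel X 0ℓ → Rel X 0ℓ
iter zero    f R = R
iter (suc k) f R = f (iter k f R)

module Dq {X : Set} (_≤_ E : Rel X 0ℓ) (α β : X → X) where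

  -- R ∈ Up(E): R ⊆ E and R is an up-set of (E, ⪯), where
  -- (u,v) ⪯ (x,y) iff x ≤ u and v ≤ y.
  IsUp : Rel X 0ℓ → Set
  IsUp R = (R ⊆ᵣ E) × (∀ u v x y → E x y → R u v → x ≤ u → v ≤ y → R x y)

  _ᶜ : Rel X 0ℓ → Rel X 0ℓ
  (R ᶜ) x y = E x y × ¬ R x y

  𝟙 : Rel X 0ℓ
  𝟙 = _≤_

  𝟘 : Rel X 0ℓ
  𝟘 = graph α ⨾ ((_≤_ ᶜ) ⌣)

  ∼_ : Rel X 0ℓ → Rel X 0ℓ
  ∼ R = ((R ⌣) ⨾ (𝟘 ᶜ)) ᶜ

  -_ : Rel X 0ℓ → Rel X 0ℓ
  - R = ((𝟘 ᶜ) ⨾ (R ⌣)) ᶜ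

  _′ : Rel X 0ℓ → Rel X 0ℓ
  R ′ = graph α ⨾ graph β ⨾ (R ᶜ) ⨾ graph β

  _▽_ : Rel X 0ℓ → ℕ → Rel X 0ℓ
  R ▽ n = iter (2 * n) ∼_ (R ′)

  _△_ : Rel X 0ℓ → ℕ → Rel X 0ℓ
  R △ n = iter (2 * n) -_ (R ′)

-- Within E, the constant 𝟘ᶜ relates z to y exactly when y ≤ α z, so on up-sets the two
-- negations act pointwise: ∼ S (x , y) ⇔ ¬ S (α⁻¹ y , x) and - S (x , y) ⇔ ¬ S (y , α x).
-- Hence ∼ ∼ conjugates an up-set by α⁻¹ and - - by α.  Writing R ′[ γ ] for R ′ with β
-- replaced by γ, one has R ′[ γ ] (x , y) ⇔ Rᶜ (γ (α x) , γ y), and together with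
-- γ = α ∘ γ ∘ α this gives ∼ ∼ (R ′[ γ ]) = R ′[ α ∘ γ ] and - - (R ′[ γ ]) = R ′[ γ ∘ α ].
-- Both compositions keep the properties required of β, so β▽ n = αⁿ ∘ β and β△ n = β ∘ αⁿ.
-- Constructively the pointwise descriptions hold only up to double negation, which R ′[ γ ]
-- absorbs because it is a complement.

module Submission where

open import Defs
open import Level using (0ℓ)
open import Data.Nat using (ℕ; zero; suc; _*_)
open import Data.Nat.Properties using (*-suc)
open import Data.Product using (Σ; _×_; _,_; proj₁; proj₂)
open import Function.Base using (_∘_; id)
import Function.Construct.Composition as Composition
open import Relation.Binary.Core using (Rel; _⇔_)
open import Relation.Binary.Definitions using (Reflexive)
open import Relation.Binary.Structures using (IsPartialOrder; IsEquivalence)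
open import Relation.Binary.PropositionalEquality using (_≡_; refl; sym; trans; cong; subst; subst₂)
open import Relation.Nullary.Negation.Core using (¬_; ¬¬-map; negated-stable)

⇔-refl : {A : Set} {P : Rel A 0ℓ} → P ⇔ P
⇔-refl = id , id

⇔-sym : {A : Set} {P Q : Rel A 0ℓ} → P ⇔ Q → Q ⇔ P
⇔-sym (to , from) = from , to

⇔-trans : {A : Set} {P Q S : Rel A 0ℓ} → P ⇔ Q → Q ⇔ S → P ⇔ S
⇔-trans (to , from) (to′ , from′) = to′ ∘ to , from ∘ from′

⇔-reflexive : {A : Set} {P Q : Rel A 0ℓ} → P ≡ Q → P ⇔ Q
⇔-reflexive refl = ⇔-refl

iter-2*suc : {A : Set} (f : Rel A 0ℓ → Rel A 0ℓ) (R : Rel A 0ℓ) (n : ℕ)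
  → iter (2 * suc n) f R ≡ f (f (iter (2 * n) f R))
iter-2*suc f R n = cong (λ k → iter k f R) (*-suc 2 n)

module _ {X : Set} {_≤_ : Rel X 0ℓ} {α γ : X → X} (α-aut : IsOrderAut _≤_ α) (γ-aut : IsDualOrderAut _≤_ γ) where

  orderAut∘dualOrderAut : IsDualOrderAut _≤_ (α ∘ γ)
  orderAut∘dualOrderAut =
      Composition.bijective _≡_ _≡_ _≡_ (proj₁ γ-aut) (proj₁ α-aut)
    , λ x y → proj₁ (proj₂ α-aut (γ y) (γ x)) ∘ proj₁ (proj₂ γ-aut x y)
            , proj₂ (proj₂ γ-aut x y) ∘ proj₂ (proj₂ α-aut (γ y) (γ x))

  dualOrderAut∘orderAut : IsDualOrderAut _≤_ (γ ∘ α)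
  dualOrderAut∘orderAut =
      Composition.bijective _≡_ _≡_ _≡_ (proj₁ α-aut) (proj₁ γ-aut)
    , λ x y → proj₁ (proj₂ γ-aut (α x) (α y)) ∘ proj₁ (proj₂ α-aut x y)
            , proj₂ (proj₂ α-aut x y) ∘ proj₂ (proj₂ γ-aut (α x) (α y))

graph-conjugate : {X : Set} {α γ : X → X} → (∀ x → γ x ≡ α (γ (α x)))
  → graph γ ⇔ (graph α ⨾ graph γ ⨾ graph α)
graph-conjugate {α = α} {γ} conj =
    (λ { {x} refl → α x , refl , γ (α x) , refl , sym (conj x) })
  , (λ { {x} (_ , refl , _ , refl , eq) → trans (conj x) eq })

graph-conjugate⁻¹ : {X : Set} {α γ : X → X} → graph γ ⇔ (graph α ⨾ graph γ ⨾ graph α)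
  → ∀ x → γ x ≡ α (γ (α x))
graph-conjugate⁻¹ {γ = γ} (to , _) x with to {x} {γ x} refl
... | _ , refl , _ , refl , eq = sym eq

module DoubleNegations {X : Set} {_≤_ E : Rel X 0ℓ} {α β : X → X}
  (≤-refl : Reflexive _≤_) (E-equiv : IsEquivalence E)
  (α-aut : IsOrderAut _≤_ α) (α⊆E : graph α ⊆ᵣ E) where

  open Dq _≤_ E α β
  open IsEquivalence E-equiv using () renaming (refl to E-refl; sym to E-sym; trans to E-trans)

  ClassPreserving : (X → X) → Set
  ClassPreserving f = ∀ x → E x (f x)

  E-cong₂ : ∀ {f g} → ClassPreserving f → ClassPreserving g → ∀ {x y} → E x y → E (f x) (g y)
  E-cong₂ f-cp g-cp {x} {y} e = E-trans (E-sym (f-cp x)) (E-trans e (g-cp y))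

  ∘-classPreserving : ∀ {f g} → ClassPreserving f → ClassPreserving g → ClassPreserving (f ∘ g)
  ∘-classPreserving {g = g} f-cp g-cp x = E-trans (g-cp x) (f-cp (g x))

  id-classPreserving : ClassPreserving id
  id-classPreserving _ = E-refl

  α-monotone : ∀ {x y} → x ≤ y → α x ≤ α y
  α-monotone {x} {y} = proj₁ (proj₂ α-aut x y)

  α-reflecting : ∀ {x y} → α x ≤ α y → x ≤ y
  α-reflecting {x} {y} = proj₂ (proj₂ α-aut x y)

  α-classPreserving : ClassPreserving α
  α-classPreserving x = α⊆E x (α x) refl

  α⁻¹ : X → X
  α⁻¹ y = proj₁ (proj₂ (proj₁ α-aut) y)

  α∘α⁻¹ : ∀ y → α (α⁻¹ y) ≡ y
  α∘α⁻¹ y = proj₂ (proj₂ (proj₁ α-aut) y) refl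

  α⁻¹-classPreserving : ClassPreserving α⁻¹
  α⁻¹-classPreserving y = E-sym (subst (E (α⁻¹ y)) (α∘α⁻¹ y) (α-classPreserving (α⁻¹ y)))

  α⁻¹-adjoint : ∀ {y z} → y ≤ α z → α⁻¹ y ≤ z
  α⁻¹-adjoint {y} le = α-reflecting (subst (_≤ _) (sym (α∘α⁻¹ y)) le)

  ≤-α∘α⁻¹ : ∀ y → y ≤ α (α⁻¹ y)
  ≤-α∘α⁻¹ y = subst (y ≤_) (sym (α∘α⁻¹ y)) ≤-refl

  𝟘ᶜ-intro : ∀ {z y} → E z y → y ≤ α z → (𝟘 ᶜ) z y
  𝟘ᶜ-intro e le = e , λ { (_ , refl , _ , y≰αz) → y≰αz le }

  𝟘ᶜ-elim : ∀ {z y} → (𝟘 ᶜ) z y → ¬ ¬ (y ≤ α z)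
  𝟘ᶜ-elim {z} (e , not𝟘) y≰αz = not𝟘 (α z , refl , E-trans (E-sym e) (α-classPreserving z) , y≰αz)

  IsUp-resp-⇔ : ∀ {S S′} → S ⇔ S′ → IsUp S → IsUp S′
  IsUp-resp-⇔ (to , from) (S⊆E , up) =
      (λ x y → S⊆E x y ∘ from)
    , (λ u v x y e s x≤u v≤y → to (up u v x y e (from s) x≤u v≤y))

  ᶜ-down : ∀ {R} → IsUp R → ∀ {u v x y} → (R ᶜ) u v → E x y → u ≤ x → y ≤ v → (R ᶜ) x y
  ᶜ-down (_ , up) {u} {v} {x} {y} (e , ¬r) e′ u≤x y≤v = e′ , λ r → ¬r (up x y u v e r u≤x y≤v)

  ∼-cong : ∀ {S S′} → S ⇔ S′ → (∼ S) ⇔ (∼ S′)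
  ∼-cong (to , from) =
      (λ { (e , n) → e , λ { (z , s , o) → n (z , from s , o) } })
    , (λ { (e , n) → e , λ { (z , s , o) → n (z , to s , o) } })

  minus-cong : ∀ {S S′} → S ⇔ S′ → (- S) ⇔ (- S′)
  minus-cong (to , from) =
      (λ { (e , n) → e , λ { (z , o , s) → n (z , o , from s) } })
    , (λ { (e , n) → e , λ { (z , o , s) → n (z , o , to s) } })

  ∼-pointwise : ∀ {S} → IsUp S → (∼ S) ⇔ (λ x y → S (α⁻¹ y) x) ᶜ
  ∼-pointwise (_ , up) =
      (λ { {y = y} (e , n) → e , λ s → n (α⁻¹ y , s , 𝟘ᶜ-intro (E-sym (α⁻¹-classPreserving y)) (≤-α∘α⁻¹ y)) })
    , (λ { {x} {y} (e , ¬s) → e , λ { (z , s , o) → 𝟘ᶜ-elim o λ y≤αz →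
          ¬s (up z x (α⁻¹ y) x (E-cong₂ α⁻¹-classPreserving id-classPreserving (E-sym e)) s (α⁻¹-adjoint y≤αz) ≤-refl) } })

  minus-pointwise : ∀ {S} → IsUp S → (- S) ⇔ (λ x y → S y (α x)) ᶜ
  minus-pointwise (_ , up) =
      (λ { {x} (e , n) → e , λ s → n (α x , 𝟘ᶜ-intro (α-classPreserving x) ≤-refl , s) })
    , (λ { {x} {y} (e , ¬s) → e , λ { (z , o , s) → 𝟘ᶜ-elim o λ z≤αx →
          ¬s (up y z y (α x) (E-cong₂ id-classPreserving α-classPreserving (E-sym e)) s ≤-refl z≤αx) } })

  ∼-isUp : ∀ {S} → IsUp S → IsUp (∼ S)
  ∼-isUp S-up@(_ , up) = IsUp-resp-⇔ (⇔-sym (∼-pointwise S-up))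
    ( (λ _ _ → proj₁)
    , λ u v x y e (e′ , ¬s) x≤u v≤y → e , λ s →
        ¬s (up (α⁻¹ y) x (α⁻¹ v) u (E-cong₂ α⁻¹-classPreserving id-classPreserving (E-sym e′)) s
               (α⁻¹-adjoint (subst (v ≤_) (sym (α∘α⁻¹ y)) v≤y)) x≤u) )

  minus-isUp : ∀ {S} → IsUp S → IsUp (- S)
  minus-isUp S-up@(_ , up) = IsUp-resp-⇔ (⇔-sym (minus-pointwise S-up))
    ( (λ _ _ → proj₁)
    , λ u v x y e (e′ , ¬s) x≤u v≤y → e , λ s →
        ¬s (up y (α x) v (α u) (E-cong₂ id-classPreserving α-classPreserving (E-sym e′)) s v≤y (α-monotone x≤u)) )

  ∼∼-pointwise : ∀ {S} → IsUp S → (∼ ∼ S) ⇔ (λ x y → E x y × ¬ ¬ S (α⁻¹ x) (α⁻¹ y))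
  ∼∼-pointwise S-up = ⇔-trans (∼-pointwise (∼-isUp S-up))
    ( (λ (e , n) → e , λ ¬s → n (proj₂ (∼-pointwise S-up)
                       (E-cong₂ α⁻¹-classPreserving id-classPreserving (E-sym e) , ¬s)))
    , (λ (e , ¬¬s) → e , λ t → ¬¬s (proj₂ (proj₁ (∼-pointwise S-up) t))) )

  minus²-pointwise : ∀ {S} → IsUp S → (- - S) ⇔ (λ x y → E x y × ¬ ¬ S (α x) (α y))
  minus²-pointwise S-up = ⇔-trans (minus-pointwise (minus-isUp S-up))
    ( (λ (e , n) → e , λ ¬s → n (proj₂ (minus-pointwise S-up)
                       (E-cong₂ id-classPreserving α-classPreserving (E-sym e) , ¬s)))
    , (λ (e , ¬¬s) → e , λ t → ¬¬s (proj₂ (proj₁ (minus-pointwise S-up) t))) )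

  record Admissible (γ : X → X) : Set where
    field
      dualOrderAut : IsDualOrderAut _≤_ γ
      selfInverse  : SelfInverse γ
      graph⊆E      : graph γ ⊆ᵣ E
      α-conjugate  : ∀ x → γ x ≡ α (γ (α x))

    antitone : ∀ {x y} → x ≤ y → γ y ≤ γ x
    antitone {x} {y} = proj₁ (proj₂ dualOrderAut x y)

    classPreserving : ClassPreserving γ
    classPreserving x = graph⊆E x (γ x) refl

    α⁻¹-conjugate : ∀ y → γ (α⁻¹ y) ≡ α (γ y)
    α⁻¹-conjugate y = trans (α-conjugate (α⁻¹ y)) (cong (α ∘ γ) (α∘α⁻¹ y))

  open Admissible

  α∘-admissible : ∀ {γ} → Admissible γ → Admissible (α ∘ γ)
  α∘-admissible {γ} γ-adm = record
    { dualOrderAut = orderAut∘dualOrderAut α-aut (dualOrderAut γ-adm)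
    ; selfInverse  = λ x → trans (sym (α-conjugate γ-adm (γ x))) (selfInverse γ-adm x)
    ; graph⊆E      = λ { x _ refl → ∘-classPreserving α-classPreserving (classPreserving γ-adm) x }
    ; α-conjugate  = cong α ∘ α-conjugate γ-adm
    }

  ∘α-admissible : ∀ {γ} → Admissible γ → Admissible (γ ∘ α)
  ∘α-admissible {γ} γ-adm = record
    { dualOrderAut = dualOrderAut∘orderAut α-aut (dualOrderAut γ-adm)
    ; selfInverse  = λ x → trans (cong γ (sym (α-conjugate γ-adm x))) (selfInverse γ-adm x)
    ; graph⊆E      = λ { x _ refl → ∘-classPreserving (classPreserving γ-adm) α-classPreserving x }
    ; α-conjugate  = α-conjugate γ-adm ∘ α
    }

  _′[_] : Rel X 0ℓ → (X → X) → Rel X 0ℓ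
  R ′[ γ ] = graph α ⨾ graph γ ⨾ R ᶜ ⨾ graph γ

  ′-pointwise : ∀ {γ} R → SelfInverse γ → R ′[ γ ] ⇔ (λ x y → (R ᶜ) (γ (α x)) (γ y))
  ′-pointwise {γ} R γ-inv =
      (λ { {x} (_ , refl , _ , refl , w , c , refl) → subst ((R ᶜ) (γ (α x))) (sym (γ-inv w)) c })
    , (λ { {x} {y} c → α x , refl , γ (α x) , refl , γ y , c , γ-inv y })

  ′-isUp : ∀ {γ R} → Admissible γ → IsUp R → IsUp (R ′[ γ ])
  ′-isUp {γ} {R} γ-adm R-up = IsUp-resp-⇔ (⇔-sym (′-pointwise R (selfInverse γ-adm)))
    ( (λ x y (e , _) → E-trans (γα-cp x) (E-trans e (E-sym (classPreserving γ-adm y))))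
    , λ u v x y e c x≤u v≤y → ᶜ-down R-up c (E-cong₂ γα-cp (classPreserving γ-adm) e)
                                (antitone γ-adm (α-monotone x≤u)) (antitone γ-adm v≤y) )
    where
    γα-cp : ClassPreserving (γ ∘ α)
    γα-cp = ∘-classPreserving (classPreserving γ-adm) α-classPreserving

  ′-stable : ∀ {γ R} → Admissible γ → ∀ {x y} → E x y → ¬ ¬ (R ′[ γ ]) x y → (R ′[ γ ]) x y
  ′-stable {γ} {R} γ-adm e ¬¬r = proj₂ (′-pointwise R (selfInverse γ-adm))
    ( E-cong₂ (∘-classPreserving (classPreserving γ-adm) α-classPreserving) (classPreserving γ-adm) e
    , negated-stable (¬¬-map (proj₂ ∘ proj₁ (′-pointwise R (selfInverse γ-adm))) ¬¬r) )

  ′-α⁻¹ : ∀ {γ R} → Admissible γ → (λ x y → (R ′[ γ ]) (α⁻¹ x) (α⁻¹ y)) ⇔ R ′[ α ∘ γ ]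
  ′-α⁻¹ {γ} {R} γ-adm = ⇔-trans {Q = λ x y → (R ᶜ) (α (γ (α x))) (α (γ y))}
      ( (λ r → subst₂ (R ᶜ) (γ∘α∘α⁻¹ _) (α⁻¹-conjugate γ-adm _) (proj₁ γ-pointwise r))
      , (λ c → proj₂ γ-pointwise (subst₂ (R ᶜ) (sym (γ∘α∘α⁻¹ _)) (sym (α⁻¹-conjugate γ-adm _)) c)) )
      (⇔-sym (′-pointwise R (selfInverse (α∘-admissible γ-adm))))
    where
    γ-pointwise : R ′[ γ ] ⇔ (λ x y → (R ᶜ) (γ (α x)) (γ y))
    γ-pointwise = ′-pointwise R (selfInverse γ-adm)

    γ∘α∘α⁻¹ : ∀ x → γ (α (α⁻¹ x)) ≡ α (γ (α x))
    γ∘α∘α⁻¹ x = trans (cong γ (α∘α⁻¹ x)) (α-conjugate γ-adm x)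

  ′-α : ∀ {γ R} → Admissible γ → (λ x y → (R ′[ γ ]) (α x) (α y)) ⇔ R ′[ γ ∘ α ]
  ′-α {γ} {R} γ-adm = ⇔-trans {Q = λ x y → (R ᶜ) (γ (α (α x))) (γ (α y))}
    (proj₁ (′-pointwise R (selfInverse γ-adm)) , proj₂ (′-pointwise R (selfInverse γ-adm)))
    (⇔-sym (′-pointwise R (selfInverse (∘α-admissible γ-adm))))

  ¬¬-′ : ∀ {γ R} {P : Rel X 0ℓ} → Admissible γ → IsUp R → P ⇔ R ′[ γ ] → (λ x y → E x y × ¬ ¬ P x y) ⇔ R ′[ γ ]
  ¬¬-′ {γ} {R} γ-adm R-up (to , from) =
      (λ (e , ¬¬p) → ′-stable γ-adm e (¬¬-map to ¬¬p))
    , (λ {x} {y} r → proj₁ (′-isUp γ-adm R-up) x y r , λ ¬p → ¬p (from r))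

  ∼∼-′ : ∀ {γ R} → Admissible γ → IsUp R → (∼ ∼ (R ′[ γ ])) ⇔ R ′[ α ∘ γ ]
  ∼∼-′ γ-adm R-up = ⇔-trans (∼∼-pointwise (′-isUp γ-adm R-up))
    (¬¬-′ (α∘-admissible γ-adm) R-up (′-α⁻¹ γ-adm))

  minus²-′ : ∀ {γ R} → Admissible γ → IsUp R → (- - (R ′[ γ ])) ⇔ R ′[ γ ∘ α ]
  minus²-′ γ-adm R-up = ⇔-trans (minus²-pointwise (′-isUp γ-adm R-up))
    (¬¬-′ (∘α-admissible γ-adm) R-up (′-α γ-adm))

  β▽ : ℕ → X → X
  β▽ zero    = β
  β▽ (suc n) = α ∘ β▽ n

  β△ : ℕ → X → X
  β△ zero    = β
  β△ (suc n) = β△ n ∘ α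

  module _ (β-adm : Admissible β) where

    β▽-admissible : ∀ n → Admissible (β▽ n)
    β▽-admissible zero    = β-adm
    β▽-admissible (suc n) = α∘-admissible (β▽-admissible n)

    β△-admissible : ∀ n → Admissible (β△ n)
    β△-admissible zero    = β-adm
    β△-admissible (suc n) = ∘α-admissible (β△-admissible n)

    ▽-′ : ∀ {R} → IsUp R → ∀ n → (R ▽ n) ⇔ R ′[ β▽ n ]
    ▽-′ R-up zero    = ⇔-refl
    ▽-′ {R} R-up (suc n) = ⇔-trans (⇔-reflexive (iter-2*suc ∼_ (R ′) n))
      (⇔-trans (∼-cong (∼-cong (▽-′ R-up n))) (∼∼-′ (β▽-admissible n) R-up))

    △-′ : ∀ {R} → IsUp R → ∀ n → (R △ n) ⇔ R ′[ β△ n ]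
    △-′ R-up zero    = ⇔-refl
    △-′ {R} R-up (suc n) = ⇔-trans (⇔-reflexive (iter-2*suc -_ (R ′) n))
      (⇔-trans (minus-cong (minus-cong (△-′ R-up n))) (minus²-′ (β△-admissible n) R-up))

proposition3p20 : (X : Set) (_≤_ E : Rel X 0ℓ) (α β : X → X)
    → IsPartialOrder _≡_ _≤_
    → IsEquivalence E
    → _≤_ ⊆ᵣ E
    → IsOrderAut _≤_ α
    → IsDualOrderAut _≤_ β
    → SelfInverse β
    → graph α ⊆ᵣ E
    → graph β ⊆ᵣ E
    → graph β ⇔ (graph α ⨾ graph β ⨾ graph α)
    → (n : ℕ)
    → Σ (X → X) λ βt → Σ (X → X) λ βd
        → (IsDualOrderAut _≤_ βt × SelfInverse βt)
        × (IsDualOrderAut _≤_ βd × SelfInverse βd)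
        × (graph βt ⊆ᵣ E × graph βd ⊆ᵣ E)
        × (graph βt ⇔ (graph α ⨾ graph βt ⨾ graph α)
           × (graph α ⨾ graph βd ⨾ graph α) ⇔ graph βd)
        × (∀ (R : Rel X 0ℓ) → Dq.IsUp _≤_ E α β R
             → (Dq._▽_ _≤_ E α β R n ⇔ (graph α ⨾ graph βt ⨾ Dq._ᶜ _≤_ E α β R ⨾ graph βt))
             × (Dq._△_ _≤_ E α β R n ⇔ (graph α ⨾ graph βd ⨾ Dq._ᶜ _≤_ E α β R ⨾ graph βd)))
proposition3p20 X _≤_ E α β ≤-po E-equiv _ α-aut β-aut β-inv α⊆E β⊆E β-conj n =
    β▽ n , β△ n
  , (dualOrderAut ▽-adm , selfInverse ▽-adm)
  , (dualOrderAut △-adm , selfInverse △-adm)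
  , (graph⊆E ▽-adm , graph⊆E △-adm)
  , (graph-conjugate (α-conjugate ▽-adm) , ⇔-sym (graph-conjugate (α-conjugate △-adm)))
  , λ R R-up → ▽-′ β-adm R-up n , △-′ β-adm R-up n
  where
  open DoubleNegations {X} {_≤_} {E} {α} {β} (IsPartialOrder.refl ≤-po) E-equiv α-aut α⊆E
  open Admissible

  β-adm : Admissible β
  β-adm = record
    { dualOrderAut = β-aut ; selfInverse = β-inv ; graph⊆E = β⊆E ; α-conjugate = graph-conjugate⁻¹ β-conj }

  ▽-adm : Admissible (β▽ n)
  ▽-adm = β▽-admissible β-adm n

  △-adm : Admissible (β△ n)
  △-adm = β△-admissible β-adm n
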